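{- Let $R$ be an even positive integer and let $n$ be an integer with $$n\geq (R+1)\,2^{1+\lfloor \log R \rfloor}\left(R+(R+1)\,2^{\lfloor \log R \rfloor}\right)-2R.$$ Then $C_{n}(\{1,2,\dots,R\})$ admits an adjacent vertex-distinguishing proper edge-coloring with $2R+1$ colors.
   Context: $\log$ denotes the base-2 logarithm. For $n\in\mathbb{N}^*$ and $S\subset\mathbb{Z}_n$, the circulant graph $C_n(S)$ is the simple undirected graph with vertex set $\mathbb{Z}_n$ in which $i$ and $j$ are adjacent if and only if $i-j\equiv \pm s \pmod n$ for some $s\in S$. A proper edge-coloring assigns colors to edges so that edges sharing an endpoint get different colors; it is adjacent vertex-distinguishing if for every edge $uv$ the set of colors of edges incident to $u$ differs from the set of colors of edges incident to $v$. -}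

module Defs where

open import Data.Nat using (ℕ; zero; suc; _+_; _*_; _∸_; _^_; _≤_; _<_; NonZero)
open import Data.Nat.DivMod using (_%_)
open import Data.Fin using (Fin; toℕ)
open import Data.Product using (Σ; ∃; _×_)
open import Data.Sum using (_⊎_)
open import Relation.Nullary using (¬_)
open import Relation.Binary.PropositionalEquality using (_≡_; _≢_)

-- Circulant graph C_n(S) on vertex set ℤ_n = Fin n, where the connection
-- set S ⊆ ℤ is given as a predicate on ℕ (here S = {1,…,R}).
-- (j - i) mod n, computed in ℕ as (j + (n ∸ i)) % n.
diffMod : (n : ℕ) → .{{_ : NonZero n}} → Fin n → Fin n → ℕ
diffMod n i j = (toℕ j + (n ∸ toℕ i)) % n

CircAdj : (n : ℕ) → .{{_ : NonZero n}} → (S : ℕ → Set) → Fin n → Fin n → Set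
CircAdj n S i j =
  (i ≢ j) × (∃ λ s → S s × ((diffMod n j i ≡ s % n) ⊎ (diffMod n i j ≡ s % n)))

Interval1 : ℕ → ℕ → Set
Interval1 R s = (1 ≤ s) × (s ≤ R)

-- An edge-colouring with k colours of a graph given by an adjacency relation
-- on Fin n: a colour for each ordered pair, required to be symmetric so that
-- it is a colour of the (undirected) edge; only its values on edges matter.
record EdgeColoring (n k : ℕ) (Adj : Fin n → Fin n → Set) : Set where
  field
    col : Fin n → Fin n → Fin k
    sym : ∀ u v → Adj u v → col u v ≡ col v u

Proper : ∀ {n k} {Adj : Fin n → Fin n → Set} → EdgeColoring n k Adj → Set
Proper {n} {k} {Adj} c =
  ∀ u v w → Adj u v → Adj u w → v ≢ w → EdgeColoring.col c u v ≢ EdgeColoring.col c u w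

ColorSet : ∀ {n k} {Adj : Fin n → Fin n → Set} → EdgeColoring n k Adj → Fin n → Fin k → Set
ColorSet {Adj = Adj} c u x = ∃ λ w → Adj u w × (EdgeColoring.col c u w ≡ x)

AVD : ∀ {n k} {Adj : Fin n → Fin n → Set} → EdgeColoring n k Adj → Set
AVD {n} {k} {Adj} c =
  ∀ u v → Adj u v →
    ¬ (∀ (x : Fin k) → (ColorSet c u x → ColorSet c v x) × (ColorSet c v x → ColorSet c u x))

module Submission where

open import Defs
open import Data.Nat using (ℕ; suc; _+_; _*_; _∸_; _^_; _≤_; _<_; NonZero)
open import Data.Nat.Divisibility using (_∣_)
open import Data.Nat.Logarithm using (⌊log₂_⌋)
open import Data.Product using (Σ; _×_)

open import Data.Nat
open import Data.Nat.Properties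
open import Data.Nat.DivMod
open import Data.Nat.Divisibility
  using (_∤_; divides; quotient; ∣m+n∣m⇒∣n; ∣m∣n⇒∣m+n; n∣m*n; m∣m*n; ∣n⇒∣m*n; ∣⇒≤; ∣1⇒≡1;
         m%n≡0⇒n∣m; n∣m⇒m%n≡0; m∣n⇒n≡quotient*m)
open import Data.Nat.Logarithm using (⌊log₂⌋-mono-≤; ⌊log₂[2^n]⌋≡n)
open import Data.Nat.Tactic.RingSolver using (solve-∀)
open import Data.Fin using (Fin; toℕ; fromℕ<; punchOut) renaming (_≟_ to _≟ᶠ_)
open import Data.Fin.Properties
  using (toℕ<n; toℕ-injective; toℕ-fromℕ<; fromℕ<-cong; fromℕ<-injective;
         any?; punchOut-injective; injective⇒≤)
open import Data.Product using (∃; ∃₂; _,_; proj₁; proj₂)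
open import Data.Sum using (_⊎_; inj₁; inj₂)
open import Function.Definitions using (Injective)
open import Relation.Nullary using (¬_; yes; no; contradiction)
open import Relation.Binary.Definitions using (tri<; tri≈; tri>)
open import Relation.Binary.PropositionalEquality
open ≡-Reasoning

-- Write M = 2R and call a map
-- colour : ℕ → Fin (2R + 1) a window pattern for n if it is 2n-periodic and a colour recurs
-- within distance 2R only at distance exactly 2R and from an odd position.  Colour the edge
-- {u, u + s} of C_n({1,…,R}) (1 ≤ s ≤ R) by colour (2u + R + s).  At a vertex u the edge
-- colours are then colour (2u + e) for e ∈ [0, 2R] ∖ {R}; these are distinct because the window
-- starts at the even position 2u (properness), and the only colour missing at u is
-- colour (2u + R).  For adjacent u and u + s the missing colours sit at the even position
-- 2u + R (R is even) and 2u + R + 2s, so they differ: the colouring is adjacent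
-- vertex-distinguishing.
--   Window patterns come from run-length sequences: blocks "0, then M or M + 1 symbols running
-- cyclically through 1, …, M", in which every long block starts at an even position.  Taking
-- 2Rβ long and 2α short blocks per period gives period 2n with n = β·2R(R + 1) + α(2R + 1).
-- Finally the hypothesis on n yields n ≥ 2R·2R(R + 1), and every such n has this form because
-- 2R - 1 inverts 2R(R + 1) modulo 2R + 1.
--   The file develops general arithmetic lemmas, run-length sequences and their window
-- property, the two-length pattern, cyclic differences in ℤ_n and the colouring induced by a
-- pattern, the number theory for n, and then the theorem.

%-shift⇒∣ : ∀ M .{{_ : NonZero M}} x d → x % M ≡ (x + d) % M → M ∣ d
%-shift⇒∣ M x d same = ∣m+n∣m⇒∣n (divides ((x + d) / M) sum≡) (n∣m*n (x / M))
  where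
  sum≡ : x / M * M + d ≡ (x + d) / M * M
  sum≡ = +-cancelˡ-≡ (x % M) _ _ (begin
    x % M + (x / M * M + d)        ≡⟨ +-assoc (x % M) _ d ⟨
    x % M + x / M * M + d          ≡⟨ cong (_+ d) (m≡m%n+[m/n]*n x M) ⟨
    x + d                          ≡⟨ m≡m%n+[m/n]*n (x + d) M ⟩
    (x + d) % M + (x + d) / M * M  ≡⟨ cong (_+ (x + d) / M * M) same ⟨
    x % M + (x + d) / M * M        ∎)

[m+n%d]%d≡[m+n]%d : ∀ m n d .{{_ : NonZero d}} → (m + n % d) % d ≡ (m + n) % d
[m+n%d]%d≡[m+n]%d m n d = begin
  (m + n % d) % d              ≡⟨ %-distribˡ-+ m (n % d) d ⟩
  (m % d + n % d % d) % d      ≡⟨ cong (λ x → (m % d + x) % d) (m%n%n≡m%n n d) ⟩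
  (m % d + n % d) % d          ≡⟨ %-distribˡ-+ m n d ⟨
  (m + n) % d                  ∎

[m%d+n]%d≡[m+n]%d : ∀ m n d .{{_ : NonZero d}} → (m % d + n) % d ≡ (m + n) % d
[m%d+n]%d≡[m+n]%d m n d = begin
  (m % d + n) % d  ≡⟨ cong (_% d) (+-comm (m % d) n) ⟩
  (n + m % d) % d  ≡⟨ [m+n%d]%d≡[m+n]%d n m d ⟩
  (n + m) % d      ≡⟨ cong (_% d) (+-comm n m) ⟩
  (m + n) % d      ∎

even+1-odd : ∀ x → 2 ∣ x → 2 ∤ x + 1
even+1-odd x 2∣x 2∣x+1 with ∣1⇒≡1 (∣m+n∣m⇒∣n 2∣x+1 2∣x)
... | ()

period-iterate : ∀ {A : Set} (f : ℕ → A) p → (∀ j → f (j + p) ≡ f j) → ∀ q j → f (j + q * p) ≡ f j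
period-iterate f p step zero    j = cong f (+-identityʳ j)
period-iterate f p step (suc q) j = begin
  f (j + (p + q * p))  ≡⟨ cong f (+-assoc j p (q * p)) ⟨
  f (j + p + q * p)    ≡⟨ period-iterate f p step q (j + p) ⟩
  f (j + p)            ≡⟨ step j ⟩
  f j                  ∎

+-swapʳ : ∀ x y z → x + y + z ≡ x + z + y
+-swapʳ = solve-∀

prefix : (ℕ → ℕ) → ℕ → ℕ
prefix a zero    = 0
prefix a (suc k) = prefix a k + a k

prefix-mono : ∀ a {k k'} → k ≤ k' → prefix a k ≤ prefix a k'
prefix-mono a {k' = zero}   z≤n = ≤-refl
prefix-mono a {k' = suc k'} k≤k' with m≤n⇒m<n∨m≡n k≤k'
... | inj₂ refl       = ≤-refl
... | inj₁ (s≤s k≤k'') = ≤-trans (prefix-mono a k≤k'') (m≤m+n _ _)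

prefix-shift : ∀ a P → (∀ k → a (k + P) ≡ a k) → ∀ k → prefix a (k + P) ≡ prefix a k + prefix a P
prefix-shift a P periodic zero    = refl
prefix-shift a P periodic (suc k) = begin
  prefix a (k + P) + a (k + P)        ≡⟨ cong₂ _+_ (prefix-shift a P periodic k) (periodic k) ⟩
  prefix a k + prefix a P + a k       ≡⟨ +-swapʳ (prefix a k) (prefix a P) (a k) ⟩
  prefix a k + a k + prefix a P       ∎

prefix-const : ∀ a t s c → (∀ k → k < s → a (t + k) ≡ c) → prefix a (t + s) ≡ prefix a t + s * c
prefix-const a t zero    c constant = trans (cong (prefix a) (+-identityʳ t)) (sym (+-identityʳ _))
prefix-const a t (suc s) c constant = begin
  prefix a (t + suc s)              ≡⟨ cong (prefix a) (+-suc t s) ⟩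
  prefix a (t + s) + a (t + s)      ≡⟨ cong₂ _+_ (prefix-const a t s c (λ k k<s → constant k (m<n⇒m<1+n k<s)))
                                                 (constant s ≤-refl) ⟩
  prefix a t + s * c + c            ≡⟨ regroup (prefix a t) (s * c) c ⟩
  prefix a t + (c + s * c)          ∎
  where
  regroup : ∀ x y z → x + y + z ≡ x + (z + y)
  regroup = solve-∀

injective⇒surjective : ∀ {K} (f : Fin K → Fin K) → Injective _≡_ _≡_ f → ∀ y → ∃ λ x → f x ≡ y
injective⇒surjective {suc K} f f-injective y with any? (λ x → f x ≟ᶠ y)
... | yes hit  = hit
... | no  miss = contradiction (injective⇒≤ punched-injective) (<-irrefl refl)
  where
  -- f avoids y, so it factors through Fin K
  punched : Fin (suc K) → Fin K
  punched x = punchOut {i = y} {j = f x} (λ y≡fx → miss (x , sym y≡fx))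
  punched-injective : Injective _≡_ _≡_ punched
  punched-injective {x} {x′} same =
    f-injective (punchOut-injective {i = y} (λ e → miss (x , sym e)) (λ e → miss (x′ , sym e)) same)

-- The sequence built from blocks: block k is one 0 followed by h k ∈ {M, M + 1} nonzero
-- symbols, and the nonzero symbols run cyclically through 1, …, M across all blocks.
-- Its window property (a colour recurs within distance M only at distance M, from an odd
-- position) holds as soon as every long block starts at an even position.
module RunLengthSequence (M : ℕ) .{{_ : NonZero M}} (h : ℕ → ℕ)
                         (h-lower : ∀ k → M ≤ h k) (h-upper : ∀ k → h k ≤ suc M) where

  start : ℕ → ℕ
  start = prefix (λ k → suc (h k))

  before : ℕ → ℕ
  before = prefix h

  symbol : ℕ → ℕ → ℕ
  symbol k zero    = 0
  symbol k (suc r) = suc ((before k + r) % M)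

  record Position (j : ℕ) : Set where
    constructor pos
    field
      block  : ℕ
      offset : ℕ
      inside : offset ≤ h block
      exact  : start block + offset ≡ j

  locate : ∀ j → Position j
  locate zero = pos 0 0 z≤n refl
  locate (suc j) with locate j
  ... | pos k r r≤h refl with r <? h k
  ...   | yes r<h = pos k (suc r) r<h (+-suc (start k) r)
  ...   | no  r≮h = pos (suc k) 0 z≤n (begin
    start k + suc (h k) + 0   ≡⟨ +-identityʳ _ ⟩
    start k + suc (h k)       ≡⟨ cong (λ x → start k + suc x) (≤-antisym (≮⇒≥ r≮h) r≤h) ⟩
    start k + suc r           ≡⟨ +-suc (start k) r ⟩
    suc (start k + r)         ∎)

  block-before : ∀ {k k'} r → r ≤ h k → k < k' → start k + r < start k'
  block-before {k} r r≤h k<k' =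
    ≤-trans (+-monoʳ-< (start k) (s≤s r≤h)) (prefix-mono (λ k → suc (h k)) k<k')

  position-unique : ∀ {j} (p q : Position j) →
                    Position.block p ≡ Position.block q × Position.offset p ≡ Position.offset q
  position-unique (pos k r r≤h refl) (pos k' r' r'≤h eq) with <-cmp k k'
  ... | tri< k<k' _ _ =
    contradiction (block-before r r≤h k<k') (≤⇒≯ (≤-trans (m≤m+n _ r') (≤-reflexive eq)))
  ... | tri> _ _ k'<k =
    contradiction (block-before r' r'≤h k'<k) (≤⇒≯ (≤-trans (m≤m+n _ r) (≤-reflexive (sym eq))))
  ... | tri≈ _ refl _ = refl , +-cancelˡ-≡ (start k) r r' (sym eq)

  colour : ℕ → ℕ
  colour j = symbol (Position.block (locate j)) (Position.offset (locate j))

  colour-at : ∀ {j} (p : Position j) → colour j ≡ symbol (Position.block p) (Position.offset p)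
  colour-at {j} p with position-unique (locate j) p
  ... | same-block , same-offset = cong₂ symbol same-block same-offset

  colour< : ∀ j → colour j < suc M
  colour< j with locate j
  ... | pos k zero    _ _ = s≤s z≤n
  ... | pos k (suc r) _ _ = s≤s (m%n<n _ M)

  repeat-in-block : ∀ k r d → 0 < d → d ≤ M → r + d ≤ h k → symbol k r ≡ symbol k (r + d) →
                    d ≡ M × r ≡ 1 × h k ≡ suc M
  repeat-in-block k zero    (suc d) _   _   _    ()
  repeat-in-block k (suc r) d       0<d d≤M fits same = d≡M , cong suc r≡0 , long
    where
    M∣d : M ∣ d
    M∣d = %-shift⇒∣ M (before k + r) d
            (trans (suc-injective same) (cong (_% M) (sym (+-assoc (before k) r d))))
    d≡M : d ≡ M
    d≡M = ≤-antisym d≤M (∣⇒≤ {{>-nonZero 0<d}} M∣d)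
    fits′ : suc r + M ≤ h k
    fits′ = subst (λ x → suc r + x ≤ h k) d≡M fits
    r≡0 : r ≡ 0
    r≡0 = n≤0⇒n≡0 (+-cancelʳ-≤ M r 0 (≤-pred (≤-trans fits′ (h-upper k))))
    long : h k ≡ suc M
    long = ≤-antisym (h-upper k) (≤-trans (s≤s (m≤n+m M r)) fits′)

  no-repeat-across : ∀ k r r' d → r ≤ h k → d ≤ M → suc (h k) + r' ≡ r + d →
                     symbol k r ≢ symbol (suc k) r'
  no-repeat-across k zero r' d _ d≤M reach _ =
    ≤⇒≯ (≤-trans d≤M (h-lower k)) (subst (h k <_) reach (s≤s (m≤m+n (h k) r')))
  no-repeat-across k (suc r) zero      d _   _   _     ()
  no-repeat-across k (suc r) (suc r') d r<h d≤M reach same = <⇒≱ gap<M (∣⇒≤ M∣gap)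
    where
    -- the nonzero symbols at both places are 1 + o apart in the cyclic order
    o = h k + r' ∸ suc r
    o-def : suc r + o ≡ h k + r'
    o-def = m+[n∸m]≡n (≤-trans r<h (m≤m+n (h k) r'))
    d≡ : d ≡ suc (suc o)
    d≡ = +-cancelˡ-≡ r d (suc (suc o)) (begin
      r + d                 ≡⟨ cong pred reach ⟨
      h k + suc r'          ≡⟨ +-suc (h k) r' ⟩
      suc (h k + r')        ≡⟨ cong suc o-def ⟨
      suc (suc r + o)       ≡⟨ cong suc (+-suc r o) ⟨
      suc (r + suc o)       ≡⟨ +-suc r (suc o) ⟨
      r + suc (suc o)       ∎)
    gap<M : suc o < M
    gap<M = subst (_≤ M) d≡ d≤M
    shifted : before k + h k + r' ≡ before k + r + suc o
    shifted = begin
      before k + h k + r'     ≡⟨ +-assoc (before k) (h k) r' ⟩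
      before k + (h k + r')   ≡⟨ cong (before k +_) (trans (sym o-def) (sym (+-suc r o))) ⟩
      before k + (r + suc o)  ≡⟨ +-assoc (before k) r (suc o) ⟨
      before k + r + suc o    ∎
    M∣gap : M ∣ suc o
    M∣gap = %-shift⇒∣ M (before k + r) (suc o) (trans (suc-injective same) (cong (_% M) shifted))

  window : (∀ k → h k ≡ suc M → 2 ∣ start k) →
           ∀ i d → 0 < d → d ≤ M → colour i ≡ colour (i + d) → d ≡ M × 2 ∤ i
  window long-even i d 0<d d≤M = window-at (locate i)
    where
    window-at : ∀ {i} → Position i → colour i ≡ colour (i + d) → d ≡ M × 2 ∤ i
    window-at here@(pos k r r≤h refl) same with r + d ≤? h k
    ... | yes fits = conclude (repeat-in-block k r d 0<d d≤M fits (begin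
      symbol k r               ≡⟨ colour-at here ⟨
      colour (start k + r)     ≡⟨ same ⟩
      colour (start k + r + d) ≡⟨ colour-at (pos k (r + d) fits (sym (+-assoc (start k) r d))) ⟩
      symbol k (r + d)         ∎))
      where
      conclude : d ≡ M × r ≡ 1 × h k ≡ suc M → d ≡ M × 2 ∤ start k + r
      conclude (d≡M , refl , long) = d≡M , even+1-odd (start k) (long-even k long)
    ... | no spills with m≤n⇒∃[o]m+o≡n (≰⇒> spills)
    ...   | r' , reach = contradiction (begin
      symbol k r               ≡⟨ colour-at here ⟨
      colour (start k + r)     ≡⟨ same ⟩
      colour (start k + r + d) ≡⟨ colour-at there ⟩
      symbol (suc k) r'        ∎) (no-repeat-across k r r' d r≤h d≤M reach)
      where
      r'<d : r' < d
      r'<d = +-cancelˡ-≤ (h k) (suc r') d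
               (subst (_≤ h k + d) (trans (sym reach) (sym (+-suc (h k) r'))) (+-monoˡ-≤ d r≤h))
      there : Position (start k + r + d)
      there = pos (suc k) r' (≤-trans (<⇒≤ r'<d) (≤-trans d≤M (h-lower (suc k)))) (begin
        start k + suc (h k) + r'    ≡⟨ +-assoc (start k) (suc (h k)) r' ⟩
        start k + (suc (h k) + r')  ≡⟨ cong (start k +_) reach ⟩
        start k + (r + d)           ≡⟨ +-assoc (start k) r d ⟨
        start k + r + d             ∎)

  module Periodic (P : ℕ) (h-periodic : ∀ k → h (k + P) ≡ h k) (M∣before : M ∣ before P) where

    start-shift : ∀ k → start (k + P) ≡ start k + start P
    start-shift = prefix-shift (λ k → suc (h k)) P (λ k → cong suc (h-periodic k))

    symbol-shift : ∀ k r → symbol (k + P) r ≡ symbol k r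
    symbol-shift k zero    = refl
    symbol-shift k (suc r) = cong suc (begin
      (before (k + P) + r) % M       ≡⟨ cong (λ x → (x + r) % M) (prefix-shift h P h-periodic k) ⟩
      (before k + before P + r) % M  ≡⟨ cong (_% M) (+-swapʳ (before k) (before P) r) ⟩
      (before k + r + before P) % M  ≡⟨ %-remove-+ʳ (before k + r) M∣before ⟩
      (before k + r) % M             ∎)

    colour-periodic : ∀ j → colour (j + start P) ≡ colour j
    colour-periodic j = shifted (locate j)
      where
      shifted : ∀ {j} → Position j → colour (j + start P) ≡ colour j
      shifted here@(pos k r r≤h refl) = begin
        colour (start k + r + start P)  ≡⟨ colour-at (pos (k + P) r inside moved) ⟩
        symbol (k + P) r                ≡⟨ symbol-shift k r ⟩
        symbol k r                      ≡⟨ colour-at here ⟨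
        colour (start k + r)            ∎
        where
        inside : r ≤ h (k + P)
        inside = subst (r ≤_) (sym (h-periodic k)) r≤h
        moved : start (k + P) + r ≡ start k + r + start P
        moved = trans (cong (_+ r) (start-shift k)) (+-swapʳ (start k) (start P) r)

record WindowPattern (R n : ℕ) : Set where
  field
    colour   : ℕ → Fin (2 * R + 1)
    periodic : ∀ j → colour (j + 2 * n) ≡ colour j
    window   : ∀ i d → 0 < d → d ≤ 2 * R → colour i ≡ colour (i + d) → d ≡ 2 * R × 2 ∤ i

-- The window pattern for n = β·2R(R + 1) + α·(2R + 1): each period consists of 2Rβ long
-- blocks (run length M + 1, M = 2R) followed by 2α short ones (run length M).
module TwoLengths (R : ℕ) .{{_ : NonZero R}} (α β : ℕ) .{{_ : NonZero (2 * R * β + 2 * α)}} where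

  M : ℕ
  M = 2 * R

  instance
    M≢0 : NonZero M
    M≢0 = m*n≢0 2 R

  long short P : ℕ
  long  = M * β
  short = 2 * α
  P     = long + short

  runLength : ℕ → ℕ
  runLength x with x <? long
  ... | yes _ = suc M
  ... | no  _ = M

  runLength-long : ∀ x → x < long → runLength x ≡ suc M
  runLength-long x x<long with x <? long
  ... | yes _     = refl
  ... | no  x≮long = contradiction x<long x≮long

  runLength-short : ∀ x → ¬ x < long → runLength x ≡ M
  runLength-short x x≮long with x <? long
  ... | yes x<long = contradiction x<long x≮long
  ... | no  _      = refl

  h : ℕ → ℕ
  h k = runLength (k % P)

  runLength-lower : ∀ x → M ≤ runLength x
  runLength-lower x with x <? long
  ... | yes _ = n≤1+n M
  ... | no  _ = ≤-refl

  runLength-upper : ∀ x → runLength x ≤ suc M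
  runLength-upper x with x <? long
  ... | yes _ = ≤-refl
  ... | no  _ = n≤1+n M

  long-residue : ∀ x → runLength x ≡ suc M → x < long
  long-residue x is-long with x <? long
  ... | yes x<long = x<long
  ... | no  _      = contradiction (n<1+n M) (<-irrefl is-long)

  open RunLengthSequence M h (λ k → runLength-lower (k % P)) (λ k → runLength-upper (k % P))

  h-long-stretch : ∀ k → k < long → h (0 + k) ≡ suc M
  h-long-stretch k k<long =
    trans (cong runLength (m<n⇒m%n≡m (≤-trans k<long (m≤m+n long short)))) (runLength-long k k<long)

  h-short-stretch : ∀ k → k < short → h (long + k) ≡ M
  h-short-stretch k k<short =
    trans (cong runLength (m<n⇒m%n≡m (+-monoʳ-< long k<short)))
          (runLength-short (long + k) (λ lt → <⇒≱ lt (m≤m+n long k)))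

  h-periodic : ∀ k → h (k + P) ≡ h k
  h-periodic k = cong runLength ([m+n]%n≡m%n k P)

  start-long : ∀ s → s ≤ long → start s ≡ s * suc (suc M)
  start-long s s≤long = prefix-const (λ k → suc (h k)) 0 s (suc (suc M))
    (λ k k<s → cong suc (h-long-stretch k (<-≤-trans k<s s≤long)))

  start-period : start P ≡ long * suc (suc M) + short * suc M
  start-period =
    trans (prefix-const (λ k → suc (h k)) long short (suc M) (λ k k<s → cong suc (h-short-stretch k k<s)))
          (cong (_+ short * suc M) (start-long long ≤-refl))

  before-period : before P ≡ long * suc M + short * M
  before-period = trans (prefix-const h long short M h-short-stretch)
                        (cong (_+ short * M) (prefix-const h 0 long (suc M) h-long-stretch))

  M∣before-period : M ∣ before P
  M∣before-period = divides (β * suc M + short) (trans before-period (regroup M β short))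
    where
    regroup : ∀ M β a → M * β * suc M + a * M ≡ (β * suc M + a) * M
    regroup = solve-∀

  n : ℕ
  n = β * (2 * R * (R + 1)) + α * suc (2 * R)

  start-period≡2n : start P ≡ 2 * n
  start-period≡2n = trans start-period (regroup R α β)
    where
    regroup : ∀ R α β → 2 * R * β * suc (suc (2 * R)) + 2 * α * suc (2 * R)
                        ≡ 2 * (β * (2 * R * (R + 1)) + α * suc (2 * R))
    regroup = solve-∀

  open Periodic P h-periodic M∣before-period

  -- Every long block starts at an even position: the parity of start k is P-periodic, and the
  -- long blocks of the first period start at multiples of M + 2.
  long-even : ∀ k → h k ≡ suc M → 2 ∣ start k
  long-even k is-long = m%n≡0⇒n∣m (start k) 2 (begin
    start k % 2                    ≡⟨ cong (λ j → start j % 2) (m≡m%n+[m/n]*n k P) ⟩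
    start (k % P + k / P * P) % 2  ≡⟨ period-iterate (λ j → start j % 2) P parity-periodic (k / P) (k % P) ⟩
    start (k % P) % 2              ≡⟨ n∣m⇒m%n≡0 _ 2 2∣start ⟩
    0                              ∎)
    where
    parity-periodic : ∀ j → start (j + P) % 2 ≡ start j % 2
    parity-periodic j = trans (cong (_% 2) (start-shift j))
                              (%-remove-+ʳ (start j) (divides n (trans start-period≡2n (*-comm 2 n))))
    2∣start : 2 ∣ start (k % P)
    2∣start = subst (2 ∣_) (sym (start-long (k % P) (<⇒≤ (long-residue (k % P) is-long))))
                    (∣n⇒∣m*n (k % P) (divides (suc R) (double R)))
      where
      double : ∀ R → suc (suc (2 * R)) ≡ suc R * 2
      double = solve-∀

  two-length-pattern : WindowPattern R n
  two-length-pattern = record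
    { colour   = λ j → fromℕ< (colour<′ j)
    ; periodic = λ j → fromℕ<-cong _ _ (trans (cong (λ x → colour (j + x)) (sym start-period≡2n))
                                               (colour-periodic j)) _ _
    ; window   = λ i d 0<d d≤M same → window long-even i d 0<d d≤M (fromℕ<-injective _ _ _ _ same)
    }
    where
    colour<′ : ∀ j → colour j < 2 * R + 1
    colour<′ j = subst (colour j <_) (+-comm 1 M) (colour< j)

module CyclicDifference (n : ℕ) .{{_ : NonZero n}} where

  diffMod-self : ∀ u → diffMod n u u ≡ 0
  diffMod-self u = trans (cong (_% n) (m+[n∸m]≡n (<⇒≤ (toℕ<n u)))) (n%n≡0 n)

  diffMod-step : ∀ u w → (toℕ u + diffMod n u w) % n ≡ toℕ w
  diffMod-step u w = begin
    (toℕ u + (toℕ w + (n ∸ toℕ u)) % n) % n  ≡⟨ [m+n%d]%d≡[m+n]%d (toℕ u) _ n ⟩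
    (toℕ u + (toℕ w + (n ∸ toℕ u))) % n      ≡⟨ cong (_% n) (rearrange (toℕ u) (toℕ w) _) ⟩
    (toℕ w + (toℕ u + (n ∸ toℕ u))) % n      ≡⟨ cong (λ x → (toℕ w + x) % n) (m+[n∸m]≡n (<⇒≤ (toℕ<n u))) ⟩
    (toℕ w + n) % n                          ≡⟨ [m+n]%n≡m%n (toℕ w) n ⟩
    toℕ w % n                                ≡⟨ m<n⇒m%n≡m (toℕ<n w) ⟩
    toℕ w                                    ∎
    where
    rearrange : ∀ x y z → x + (y + z) ≡ y + (x + z)
    rearrange = solve-∀

  diffMod-unique : ∀ u w s → s < n → (toℕ u + s) % n ≡ toℕ w → diffMod n u w ≡ s
  diffMod-unique u w s s<n reach = begin
    (toℕ w + (n ∸ toℕ u)) % n               ≡⟨ cong (λ x → (x + (n ∸ toℕ u)) % n) reach ⟨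
    ((toℕ u + s) % n + (n ∸ toℕ u)) % n     ≡⟨ [m%d+n]%d≡[m+n]%d (toℕ u + s) _ n ⟩
    (toℕ u + s + (n ∸ toℕ u)) % n           ≡⟨ cong (_% n) (rearrange (toℕ u) s _) ⟩
    (s + (toℕ u + (n ∸ toℕ u))) % n         ≡⟨ cong (λ x → (s + x) % n) (m+[n∸m]≡n (<⇒≤ (toℕ<n u))) ⟩
    (s + n) % n                             ≡⟨ [m+n]%n≡m%n s n ⟩
    s % n                                   ≡⟨ m<n⇒m%n≡m s<n ⟩
    s                                       ∎
    where
    rearrange : ∀ x y z → x + y + z ≡ y + (x + z)
    rearrange = solve-∀

  diffMod-injective : ∀ u w w' → diffMod n u w ≡ diffMod n u w' → w ≡ w'
  diffMod-injective u w w' same =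
    toℕ-injective (trans (sym (diffMod-step u w))
                         (trans (cong (λ x → (toℕ u + x) % n) same) (diffMod-step u w')))

  diffMod-sum : ∀ u w → u ≢ w → diffMod n u w + diffMod n w u ≡ n
  diffMod-sum u w u≢w = trans (cong (s +_) back) (m+[n∸m]≡n (<⇒≤ s<n))
    where
    s = diffMod n u w
    s<n : s < n
    s<n = m%n<n _ n
    0<s : 0 < s
    0<s = n≢0⇒n>0 (λ s≡0 → u≢w (diffMod-injective u u w (trans (diffMod-self u) (sym s≡0))))
    back : diffMod n w u ≡ n ∸ s
    back = diffMod-unique w u (n ∸ s) (∸-monoʳ-< 0<s (<⇒≤ s<n)) (begin
      (toℕ w + (n ∸ s)) % n            ≡⟨ cong (λ x → (x + (n ∸ s)) % n) (diffMod-step u w) ⟨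
      ((toℕ u + s) % n + (n ∸ s)) % n  ≡⟨ [m%d+n]%d≡[m+n]%d (toℕ u + s) _ n ⟩
      (toℕ u + s + (n ∸ s)) % n        ≡⟨ cong (_% n) (+-assoc (toℕ u) s _) ⟩
      (toℕ u + (s + (n ∸ s))) % n      ≡⟨ cong (λ x → (toℕ u + x) % n) (m+[n∸m]≡n (<⇒≤ s<n)) ⟩
      (toℕ u + n) % n                  ≡⟨ [m+n]%n≡m%n (toℕ u) n ⟩
      toℕ u % n                        ≡⟨ m<n⇒m%n≡m (toℕ<n u) ⟩
      toℕ u                            ∎)

module PatternColouring (R n : ℕ) .{{_ : NonZero n}} (2R<n : 2 * R < n) (R-even : 2 ∣ R)
                        (pat : WindowPattern R n) where

  open WindowPattern pat
  open CyclicDifference n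

  Adj : Fin n → Fin n → Set
  Adj = CircAdj n (Interval1 R)

  D : Fin n → Fin n → ℕ
  D = diffMod n

  R+R≡2R : R + R ≡ 2 * R
  R+R≡2R = cong (R +_) (sym (+-identityʳ R))

  R<n : R < n
  R<n = ≤-<-trans (m≤m+n R R) (subst (_< n) (sym R+R≡2R) 2R<n)

  s%n≡s : ∀ {s} → Interval1 R s → s % n ≡ s
  s%n≡s (_ , s≤R) = m<n⇒m%n≡m (≤-<-trans s≤R R<n)

  colour-mod : ∀ a c → colour (2 * (a % n) + c) ≡ colour (2 * a + c)
  colour-mod a c = begin
    colour (2 * (a % n) + c)                    ≡⟨ period-iterate colour (2 * n) periodic (a / n) _ ⟨
    colour (2 * (a % n) + c + a / n * (2 * n))  ≡⟨ cong colour (regroup (a % n) (a / n) n c) ⟩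
    colour (2 * (a % n + a / n * n) + c)        ≡⟨ cong (λ x → colour (2 * x + c)) (m≡m%n+[m/n]*n a n) ⟨
    colour (2 * a + c)                          ∎
    where
    regroup : ∀ r q n c → 2 * r + c + q * (2 * n) ≡ 2 * (r + q * n) + c
    regroup = solve-∀

  window-distinct : ∀ i e e' → 2 ∣ i → e < e' → e' ≤ 2 * R → colour (i + e) ≢ colour (i + e')
  window-distinct i e e' 2∣i e<e' e'≤2R same = impossible (window (i + e) d 0<d d≤2R recurrence)
    where
    d = e' ∸ e
    e+d≡e' : e + d ≡ e'
    e+d≡e' = m+[n∸m]≡n (<⇒≤ e<e')
    0<d : 0 < d
    0<d = m<n⇒0<n∸m e<e'
    d≤2R : d ≤ 2 * R
    d≤2R = ≤-trans (m∸n≤m e' e) e'≤2R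
    recurrence : colour (i + e) ≡ colour (i + e + d)
    recurrence = trans same (cong colour (trans (cong (i +_) (sym e+d≡e')) (sym (+-assoc i e d))))
    -- a recurrence at distance 2R inside [0, 2R] starts at offset 0, an even position
    impossible : ¬ (d ≡ 2 * R × 2 ∤ i + e)
    impossible (d≡2R , odd) =
      odd (subst (λ x → 2 ∣ i + x) (sym e≡0) (subst (2 ∣_) (sym (+-identityʳ i)) 2∣i))
      where
      e≡0 : e ≡ 0
      e≡0 = n≤0⇒n≡0 (+-cancelʳ-≤ (2 * R) e 0
              (subst (_≤ 2 * R) (sym (trans (cong (e +_) (sym d≡2R)) e+d≡e')) e'≤2R))

  window-injective : ∀ i e e' → 2 ∣ i → e ≤ 2 * R → e' ≤ 2 * R →
                     colour (i + e) ≡ colour (i + e') → e ≡ e'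
  window-injective i e e' 2∣i e≤2R e'≤2R same with <-cmp e e'
  ... | tri< e<e' _ _ = contradiction same (window-distinct i e e' 2∣i e<e' e'≤2R)
  ... | tri≈ _ e≡e' _ = e≡e'
  ... | tri> _ _ e'<e = contradiction (sym same) (window-distinct i e' e 2∣i e'<e e≤2R)

  toℕ≤2R : (e : Fin (2 * R + 1)) → toℕ e ≤ 2 * R
  toℕ≤2R e = m<1+n⇒m≤n (subst (toℕ e <_) (+-comm (2 * R) 1) (toℕ<n e))

  window-surjective : ∀ i → 2 ∣ i → ∀ x → ∃ λ e → e ≤ 2 * R × colour (i + e) ≡ x
  window-surjective i 2∣i x with injective⇒surjective (λ e → colour (i + toℕ e)) window-map-injective x
    where
    window-map-injective : Injective _≡_ _≡_ (λ e → colour (i + toℕ e))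
    window-map-injective {e} {e'} same =
      toℕ-injective (window-injective i _ _ 2∣i (toℕ≤2R e) (toℕ≤2R e') same)
  ... | e , hit = toℕ e , toℕ≤2R e , hit

  Step : Fin n → Fin n → Set
  Step u w = Interval1 R (D u w)

  adjacent⇒step : ∀ u w → Adj u w → Step u w ⊎ Step w u
  adjacent⇒step u w (_ , s , s∈S , inj₁ back) = inj₂ (subst (Interval1 R) (sym (trans back (s%n≡s s∈S))) s∈S)
  adjacent⇒step u w (_ , s , s∈S , inj₂ fwd)  = inj₁ (subst (Interval1 R) (sym (trans fwd (s%n≡s s∈S))) s∈S)

  step⇒distinct : ∀ u w → Step u w → u ≢ w
  step⇒distinct u w (1≤D , _) refl = contradiction (diffMod-self u) (≢-nonZero⁻¹ _ {{>-nonZero 1≤D}})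

  step⇒adjacent : ∀ u w → Step u w → Adj u w
  step⇒adjacent u w step = step⇒distinct u w step , D u w , step , inj₂ (sym (s%n≡s step))

  adjacent-sym : ∀ u w → Adj u w → Adj w u
  adjacent-sym u w (u≢w , s , s∈S , inj₁ back) = (λ w≡u → u≢w (sym w≡u)) , s , s∈S , inj₂ back
  adjacent-sym u w (u≢w , s , s∈S , inj₂ fwd)  = (λ w≡u → u≢w (sym w≡u)) , s , s∈S , inj₁ fwd

  -- Between adjacent vertices, only one direction is a short step (this is where n > 2R is used).
  step⇒long-back : ∀ u w → Step w u → ¬ D u w ≤ R
  step⇒long-back u w step@(_ , D≤R) D'≤R = <⇒≱ 2R<n
    (subst₂ _≤_ (diffMod-sum u w (λ u≡w → step⇒distinct w u step (sym u≡w))) R+R≡2R (+-mono-≤ D'≤R D≤R))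

  -- The colour of the edge uw is read off at the endpoint from which the other is a short step.
  col : Fin n → Fin n → Fin (2 * R + 1)
  col u w with D u w ≤? R
  ... | yes _ = colour (2 * toℕ u + (R + D u w))
  ... | no  _ = colour (2 * toℕ w + (R + D w u))

  col-forward : ∀ u w → Step u w → col u w ≡ colour (2 * toℕ u + (R + D u w))
  col-forward u w (_ , D≤R) with D u w ≤? R
  ... | yes _   = refl
  ... | no  D≰R = contradiction D≤R D≰R

  col-backward : ∀ u w → Step w u → col u w ≡ colour (2 * toℕ w + (R + D w u))
  col-backward u w step with D u w ≤? R
  ... | yes D≤R = contradiction D≤R (step⇒long-back u w step)
  ... | no  _   = refl

  col-sym : ∀ u w → Adj u w → col u w ≡ col w u
  col-sym u w adj with adjacent⇒step u w adj
  ... | inj₁ step = trans (col-forward u w step) (sym (col-backward w u step))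
  ... | inj₂ step = trans (col-backward u w step) (sym (col-forward w u step))

  colouring : EdgeColoring n (2 * R + 1) Adj
  colouring = record { col = col ; sym = col-sym }

  -- Offsets e ∈ [0, 2R] ∖ {R}, standing for the step e - R from a vertex.
  data Offset : ℕ → Set where
    ahead  : ∀ s → Interval1 R s → Offset (R + s)
    behind : ∀ s → Interval1 R s → Offset (R ∸ s)

  offset-view : ∀ e → e ≤ 2 * R → e ≢ R → Offset e
  offset-view e e≤2R e≢R with <-cmp e R
  ... | tri< e<R _ _ = subst Offset (m∸[m∸n]≡n (<⇒≤ e<R)) (behind (R ∸ e) (m<n⇒0<n∸m e<R , m∸n≤m R e))
  ... | tri≈ _ e≡R _ = contradiction e≡R e≢R
  ... | tri> _ _ R<e = subst Offset (m+[n∸m]≡n (<⇒≤ R<e)) (ahead (e ∸ R) (m<n⇒0<n∸m R<e , e∸R≤R))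
    where
    e∸R≤R : e ∸ R ≤ R
    e∸R≤R = subst (e ∸ R ≤_) (m+n∸m≡n R R) (∸-monoˡ-≤ R (subst (e ≤_) (sym R+R≡2R) e≤2R))

  offset≤2R : ∀ {e} → Offset e → e ≤ 2 * R
  offset≤2R (ahead  s (_ , s≤R)) = subst (R + s ≤_) R+R≡2R (+-monoʳ-≤ R s≤R)
  offset≤2R (behind s _)         = ≤-trans (m∸n≤m R s) (subst (R ≤_) R+R≡2R (m≤m+n R R))

  offset≢R : ∀ {e} → Offset e → e ≢ R
  offset≢R (ahead  s (1≤s , _))   R+s≡R =
    <⇒≢ 1≤s (sym (+-cancelˡ-≡ R s 0 (trans R+s≡R (sym (+-identityʳ R)))))
  offset≢R (behind s (1≤s , s≤R)) R∸s≡R =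
    <⇒≢ 1≤s (sym (+-cancelˡ-≡ R s 0
      (trans (trans (cong (_+ s) (sym R∸s≡R)) (m∸n+n≡m s≤R)) (sym (+-identityʳ R)))))

  neighbour : Fin n → ℕ → Fin n
  neighbour u e = fromℕ< (m%n<n (toℕ u + (n + e ∸ R)) n)

  D-neighbour : ∀ u e → D u (neighbour u e) ≡ (n + e ∸ R) % n
  D-neighbour u e =
    diffMod-unique u _ _ (m%n<n _ n) (trans ([m+n%d]%d≡[m+n]%d (toℕ u) _ n) (sym (toℕ-fromℕ< _)))

  D-ahead : ∀ u s → s < n → D u (neighbour u (R + s)) ≡ s
  D-ahead u s s<n = begin
    D u (neighbour u (R + s))  ≡⟨ D-neighbour u (R + s) ⟩
    (n + (R + s) ∸ R) % n      ≡⟨ cong (λ x → (x ∸ R) % n) (rearrange n R s) ⟩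
    (s + n + R ∸ R) % n        ≡⟨ cong (_% n) (m+n∸n≡m (s + n) R) ⟩
    (s + n) % n                ≡⟨ [m+n]%n≡m%n s n ⟩
    s % n                      ≡⟨ m<n⇒m%n≡m s<n ⟩
    s                          ∎
    where
    rearrange : ∀ n R s → n + (R + s) ≡ s + n + R
    rearrange = solve-∀

  D-behind : ∀ u s → Interval1 R s → D u (neighbour u (R ∸ s)) ≡ n ∸ s
  D-behind u s (1≤s , s≤R) = begin
    D u (neighbour u (R ∸ s))          ≡⟨ D-neighbour u (R ∸ s) ⟩
    (n + (R ∸ s) ∸ R) % n              ≡⟨ cong (_% n) (cong₂ _∸_ (+-comm n (R ∸ s)) (sym (m∸n+n≡m s≤R))) ⟩
    ((R ∸ s) + n ∸ ((R ∸ s) + s)) % n  ≡⟨ cong (_% n) ([m+n]∸[m+o]≡n∸o (R ∸ s) n s) ⟩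
    (n ∸ s) % n                        ≡⟨ m<n⇒m%n≡m (∸-monoʳ-< 1≤s (≤-trans s≤R (<⇒≤ R<n))) ⟩
    n ∸ s                              ∎

  D-opposite : ∀ u w → u ≢ w → D u w ≡ n ∸ D w u
  D-opposite u w u≢w = trans (sym (m+n∸n≡m (D u w) (D w u))) (cong (_∸ D w u) (diffMod-sum u w u≢w))

  neighbour-edge : ∀ u {e} → Offset e →
                   Adj u (neighbour u e) × col u (neighbour u e) ≡ colour (2 * toℕ u + e)
  neighbour-edge u (ahead s s∈S@(_ , s≤R)) =
    step⇒adjacent u w step , trans (col-forward u w step) (cong (λ x → colour (2 * toℕ u + (R + x))) D≡s)
    where
    w = neighbour u (R + s)
    D≡s : D u w ≡ s
    D≡s = D-ahead u s (≤-<-trans s≤R R<n)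
    step : Step u w
    step = subst (Interval1 R) (sym D≡s) s∈S
  neighbour-edge u (behind s s∈S@(_ , s≤R)) = adjacent-sym w u (step⇒adjacent w u step) , (begin
    col u w                                  ≡⟨ col-backward u w step ⟩
    colour (2 * toℕ w + (R + D w u))         ≡⟨ cong (λ x → colour (2 * toℕ w + (R + x))) D'≡s ⟩
    colour (2 * toℕ w + (R + s))             ≡⟨ cong (λ x → colour (2 * toℕ w + (x + s))) (m∸n+n≡m s≤R) ⟨
    colour (2 * toℕ w + ((R ∸ s) + s + s))   ≡⟨ cong colour (regroup (toℕ w) s (R ∸ s)) ⟩
    colour (2 * (toℕ w + s) + (R ∸ s))       ≡⟨ colour-mod (toℕ w + s) (R ∸ s) ⟨
    colour (2 * ((toℕ w + s) % n) + (R ∸ s)) ≡⟨ cong (λ x → colour (2 * x + (R ∸ s))) reach ⟩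
    colour (2 * toℕ u + (R ∸ s))             ∎)
    where
    w = neighbour u (R ∸ s)
    s<n : s < n
    s<n = ≤-<-trans s≤R R<n
    D≡n∸s : D u w ≡ n ∸ s
    D≡n∸s = D-behind u s s∈S
    u≢w : u ≢ w
    u≢w u≡w = <⇒≢ (m<n⇒0<n∸m s<n) (trans (sym (diffMod-self u)) (trans (cong (D u) u≡w) D≡n∸s))
    D'≡s : D w u ≡ s
    D'≡s = trans (D-opposite w u (λ w≡u → u≢w (sym w≡u))) (trans (cong (n ∸_) D≡n∸s) (m∸[m∸n]≡n (<⇒≤ s<n)))
    step : Step w u
    step = subst (Interval1 R) (sym D'≡s) s∈S
    reach : (toℕ w + s) % n ≡ toℕ u
    reach = trans (cong (λ x → (toℕ w + x) % n) (sym D'≡s)) (diffMod-step w u)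
    regroup : ∀ w s x → 2 * w + (x + s + s) ≡ 2 * (w + s) + x
    regroup = solve-∀

  neighbour-of : ∀ u w → Adj u w → ∃ λ e → Offset e × w ≡ neighbour u e
  neighbour-of u w adj with adjacent⇒step u w adj
  ... | inj₁ step@(_ , s≤R) =
    R + D u w , ahead (D u w) step , diffMod-injective u _ _ (sym (D-ahead u (D u w) (≤-<-trans s≤R R<n)))
  ... | inj₂ step =
    R ∸ D w u , behind (D w u) step , diffMod-injective u _ _
      (trans (D-opposite u w (λ u≡w → step⇒distinct w u step (sym u≡w))) (sym (D-behind u (D w u) step)))

  -- Properness: two neighbours with equal edge colours have equal offsets, hence coincide.
  proper : Proper colouring
  proper u v w adj-v adj-w v≢w same with neighbour-of u v adj-v | neighbour-of u w adj-w
  ... | e , off , refl | e' , off' , refl =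
    v≢w (cong (neighbour u) (window-injective (2 * toℕ u) e e' (m∣m*n (toℕ u)) (offset≤2R off) (offset≤2R off')
      (begin
        colour (2 * toℕ u + e)   ≡⟨ proj₂ (neighbour-edge u off) ⟨
        col u (neighbour u e)    ≡⟨ same ⟩
        col u (neighbour u e')   ≡⟨ proj₂ (neighbour-edge u off') ⟩
        colour (2 * toℕ u + e')  ∎)))

  -- The missing colours colour (2u + R) of adjacent vertices differ (this is where R even is used).
  missing-differ : ∀ u v → Step u v → colour (2 * toℕ u + R) ≢ colour (2 * toℕ v + R)
  missing-differ u v (1≤s , s≤R) same =
    proj₂ (window (2 * toℕ u + R) (2 * s) (≤-trans (s≤s z≤n) (*-monoʳ-≤ 2 1≤s)) (*-monoʳ-≤ 2 s≤R) recurrence)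
          (∣m∣n⇒∣m+n (m∣m*n (toℕ u)) R-even)
    where
    s = D u v
    recurrence : colour (2 * toℕ u + R) ≡ colour (2 * toℕ u + R + 2 * s)
    recurrence = begin
      colour (2 * toℕ u + R)               ≡⟨ same ⟩
      colour (2 * toℕ v + R)               ≡⟨ cong (λ x → colour (2 * x + R)) (diffMod-step u v) ⟨
      colour (2 * ((toℕ u + s) % n) + R)   ≡⟨ colour-mod (toℕ u + s) R ⟩
      colour (2 * (toℕ u + s) + R)         ≡⟨ cong colour (regroup (toℕ u) s R) ⟩
      colour (2 * toℕ u + R + 2 * s)       ∎
      where
      regroup : ∀ u s R → 2 * (u + s) + R ≡ 2 * u + R + 2 * s
      regroup = solve-∀

  missing-distinct : ∀ u v → Adj u v → colour (2 * toℕ u + R) ≢ colour (2 * toℕ v + R)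
  missing-distinct u v adj with adjacent⇒step u v adj
  ... | inj₁ step = missing-differ u v step
  ... | inj₂ step = λ same → missing-differ v u step (sym same)

  -- The colour missing at v is present at any neighbour u of v.
  avd : AVD colouring
  avd u v adj same-sets = absent-at-v (proj₁ (same-sets x) present-at-u)
    where
    x = colour (2 * toℕ v + R)
    R≤2R : R ≤ 2 * R
    R≤2R = subst (R ≤_) R+R≡2R (m≤m+n R R)
    present-at-u : ColorSet colouring u x
    present-at-u with window-surjective (2 * toℕ u) (m∣m*n (toℕ u)) x
    ... | e , e≤2R , hit = neighbour u e , proj₁ edge , trans (proj₂ edge) hit
      where
      e≢R : e ≢ R
      e≢R refl = missing-distinct u v adj hit
      edge = neighbour-edge u (offset-view e e≤2R e≢R)
    absent-at-v : ¬ ColorSet colouring v x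
    absent-at-v (w , adj-w , hit) with neighbour-of v w adj-w
    ... | e , off , refl = offset≢R off
      (window-injective (2 * toℕ v) e R (m∣m*n (toℕ v)) (offset≤2R off) R≤2R
        (trans (sym (proj₂ (neighbour-edge v off))) hit))

-- If K·A ≡ 1 (mod m + 1), every n ≥ m·A is a combination β·A + α·(m + 1) with α, β ≥ 0:
-- take β ≡ K·n (mod m + 1), so that β·A ≡ n while β·A ≤ m·A ≤ n.
representation : ∀ m A K c n → K * A ≡ 1 + suc m * c → m * A ≤ n → ∃₂ λ α β → n ≡ β * A + α * suc m
representation m A K c n inverse large = quotient m+1∣rest , β , (begin
  n                                 ≡⟨ m+[n∸m]≡n βA≤n ⟨
  β * A + (n ∸ β * A)               ≡⟨ cong (β * A +_) (m∣n⇒n≡quotient*m m+1∣rest) ⟩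
  β * A + quotient m+1∣rest * suc m ∎)
  where
  β = (K * n) % suc m
  t = (K * n) / suc m
  βA≤n : β * A ≤ n
  βA≤n = ≤-trans (*-monoˡ-≤ A (m<1+n⇒m≤n (m%n<n (K * n) (suc m)))) large
  rest = n ∸ β * A
  congruent : β * A + suc m * (t * A) ≡ n + suc m * (n * c)
  congruent = begin
    β * A + suc m * (t * A)    ≡⟨ regroup₁ β (suc m) t A ⟩
    (β + t * suc m) * A        ≡⟨ cong (_* A) (m≡m%n+[m/n]*n (K * n) (suc m)) ⟨
    K * n * A                  ≡⟨ regroup₂ K n A ⟩
    n * (K * A)                ≡⟨ cong (n *_) inverse ⟩
    n * (1 + suc m * c)        ≡⟨ regroup₃ n (suc m) c ⟩
    n + suc m * (n * c)        ∎
    where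
    regroup₁ : ∀ β m t A → β * A + m * (t * A) ≡ (β + t * m) * A
    regroup₁ = solve-∀
    regroup₂ : ∀ K n A → K * n * A ≡ n * (K * A)
    regroup₂ = solve-∀
    regroup₃ : ∀ n m c → n * (1 + m * c) ≡ n + m * (n * c)
    regroup₃ = solve-∀
  m+1∣rest : suc m ∣ rest
  m+1∣rest = ∣m+n∣m⇒∣n (divides (t * A) sum≡) (divides (n * c) (*-comm (suc m) (n * c)))
    where
    sum≡ : suc m * (n * c) + rest ≡ t * A * suc m
    sum≡ = +-cancelˡ-≡ (β * A) _ _ (begin
      β * A + (suc m * (n * c) + rest)  ≡⟨ regroup (β * A) _ rest ⟩
      β * A + rest + suc m * (n * c)    ≡⟨ cong (_+ suc m * (n * c)) (m+[n∸m]≡n βA≤n) ⟩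
      n + suc m * (n * c)               ≡⟨ congruent ⟨
      β * A + suc m * (t * A)           ≡⟨ cong (β * A +_) (*-comm (suc m) (t * A)) ⟩
      β * A + t * A * suc m             ∎)
      where
      regroup : ∀ x y z → x + (y + z) ≡ x + z + y
      regroup = solve-∀

below-next-power : ∀ R → R < 2 * 2 ^ ⌊log₂ R ⌋
below-next-power R with 2 * 2 ^ ⌊log₂ R ⌋ ≤? R
... | no  above = ≰⇒> above
... | yes below =
  contradiction (subst (_≤ ⌊log₂ R ⌋) (⌊log₂[2^n]⌋≡n (suc ⌊log₂ R ⌋)) (⌊log₂⌋-mono-≤ below)) (<-irrefl refl)

threshold : ∀ R n → 1 ≤ R →
  (R + 1) * 2 ^ (1 + ⌊log₂ R ⌋) * (R + (R + 1) * 2 ^ ⌊log₂ R ⌋) ∸ 2 * R ≤ n →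
  2 * R * (2 * R * (R + 1)) ≤ n
threshold R@(suc r) n _ large = ≤-trans (m+n≤o⇒m≤o∸n _ core) large
  where
  Q = 2 ^ ⌊log₂ R ⌋
  R+1≤2Q : R + 1 ≤ 2 * Q
  R+1≤2Q = subst (_≤ 2 * Q) (+-comm 1 R) (below-next-power R)
  -- after doubling, replace 2Q by its lower bound R + 1 and compare polynomials in R
  doubled : 2 * (2 * R * (2 * R * (R + 1)) + 2 * R) ≤ 2 * ((R + 1) * (2 * Q) * (R + (R + 1) * Q))
  doubled = ≤-trans (m≤m+n _ _) (≤-trans (≤-reflexive (sym (polynomial r)))
                                (≤-trans replace-2Q (≤-reflexive (sym (regroup R Q)))))
    where
    replace-2Q : (R + 1) * (R + 1) * (2 * R + (R + 1) * (R + 1))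
                 ≤ (R + 1) * (2 * Q) * (2 * R + (R + 1) * (2 * Q))
    replace-2Q = *-mono-≤ (*-monoʳ-≤ (R + 1) R+1≤2Q) (+-monoʳ-≤ (2 * R) (*-monoʳ-≤ (R + 1) R+1≤2Q))
    polynomial : ∀ r → (suc r + 1) * (suc r + 1) * (2 * suc r + (suc r + 1) * (suc r + 1))
                       ≡ 2 * (2 * suc r * (2 * suc r * (suc r + 1)) + 2 * suc r)
                         + ((suc r * suc r) * (r * r) + (suc r + 1) * (suc r + 1))
    polynomial = solve-∀
    regroup : ∀ R Q → 2 * ((R + 1) * (2 * Q) * (R + (R + 1) * Q))
                      ≡ (R + 1) * (2 * Q) * (2 * R + (R + 1) * (2 * Q))
    regroup = solve-∀
  core : 2 * R * (2 * R * (R + 1)) + 2 * R ≤ (R + 1) * (2 * Q) * (R + (R + 1) * Q)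
  core = *-cancelˡ-≤ 2 doubled

representable : ∀ R n → 1 ≤ R → 2 * R * (2 * R * (R + 1)) ≤ n →
  ∃₂ λ α β → n ≡ β * (2 * R * (R + 1)) + α * suc (2 * R)
representable (suc r) n _ =
  representation (2 * suc r) (2 * suc r * (suc r + 1)) (suc (2 * r)) (2 * r * r + 4 * r + 1) n (inverse r)
  where
  -- 2R - 1 is an inverse of 2R(R + 1) modulo 2R + 1
  inverse : ∀ r → suc (2 * r) * (2 * suc r * (suc r + 1))
                  ≡ 1 + suc (2 * suc r) * (2 * r * r + 4 * r + 1)
  inverse = solve-∀

threshold⇒2R<n : ∀ R n → 1 ≤ R → 2 * R * (2 * R * (R + 1)) ≤ n → 2 * R < n
threshold⇒2R<n R@(suc _) n 1≤R large = <-≤-trans (m<m*n (2 * R) (2 * R * (R + 1)) 1<A) large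
  where
  1<A : 1 < 2 * R * (R + 1)
  1<A = *-mono-≤ (*-monoʳ-≤ 2 1≤R) (m≤n+m 1 R)

period-nonzero : ∀ R n α β → 1 ≤ R → .{{NonZero n}} → n ≡ β * (2 * R * (R + 1)) + α * suc (2 * R) →
                 NonZero (2 * R * β + 2 * α)
period-nonzero (suc r) n α       (suc β) _ _   = _
period-nonzero (suc r) n (suc α) zero    _ _   =
  >-nonZero (≤-trans (s≤s z≤n) (m≤n+m (2 * suc α) (2 * suc r * 0)))
period-nonzero (suc r) n zero    zero    _ n≡0 = contradiction n≡0 (≢-nonZero⁻¹ n)

theorem2 : (R n : ℕ) → 1 ≤ R → 2 ∣ R →
    (R + 1) * 2 ^ (1 + ⌊log₂ R ⌋) * (R + (R + 1) * 2 ^ ⌊log₂ R ⌋) ∸ 2 * R ≤ n →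
    (nz : NonZero n) →
    Σ (EdgeColoring n (2 * R + 1) (CircAdj n {{nz}} (Interval1 R)))
      (λ c → Proper c × AVD c)
theorem2 R n 1≤R 2∣R bound nz = colour-with (representable R n 1≤R large)
  where
  instance
    _ = nz
    _ = >-nonZero 1≤R
  large : 2 * R * (2 * R * (R + 1)) ≤ n
  large = threshold R n 1≤R bound
  colour-with : (∃₂ λ α β → n ≡ β * (2 * R * (R + 1)) + α * suc (2 * R)) →
                Σ (EdgeColoring n (2 * R + 1) (CircAdj n (Interval1 R))) (λ c → Proper c × AVD c)
  colour-with (α , β , n≡) = colouring , proper , avd
    where
    instance
      _ = period-nonzero R n α β 1≤R n≡
    open PatternColouring R n (threshold⇒2R<n R n 1≤R large) 2∣R
           (subst (WindowPattern R) (sym n≡) (TwoLengths.two-length-pattern R α β))
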